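{- Let $\mathfrak{t}$ be a term over $\{\mathsf{M}\}$. (i) $\mathfrak{t}$ is a maximal element of the poset of all terms ordered by $\preccurlyeq$ if and only if $\mathfrak{t}$ avoids $\mathsf{M}(\mathsf{x}_1\mathsf{x}_2)$ and suffix-avoids $\mathsf{M}\mathsf{x}_1$. (ii) $\mathfrak{t}$ is a minimal element of this poset if and only if $\mathfrak{t}$ avoids $(\mathsf{x}_1\mathsf{x}_2)(\mathsf{x}_1\mathsf{x}_2)$ and suffix-avoids $\mathsf{x}_1\mathsf{x}_1$.
   Context: Terms over $\{\mathsf{M}\}$: variables $\mathsf{x}_i$, the constant $\mathsf{M}$, and applications $\mathfrak{t}_1\mathfrak{t}_2$ (binary trees). $\mathfrak{t}\Rightarrow\mathfrak{t}'$ iff $\mathfrak{t}'$ is obtained from $\mathfrak{t}$ by replacing one subterm $\mathsf{M}\mathfrak{s}$ by $\mathfrak{s}\mathfrak{s}$; $\preccurlyeq$ is its reflexive transitive closure, a partial order on all terms. For a term $\mathfrak{s}$ with variables among $\mathsf{x}_1,\dots,\mathsf{x}_m$: $\mathfrak{t}$ avoids $\mathfrak{s}$ if no subterm of $\mathfrak{t}$ is of the form $\mathfrak{s}[\mathfrak{r}_1,\dots,\mathfrak{r}_m]$ (simultaneous substitution of arbitrary terms $\mathfrak{r}_j$ for $\mathsf{x}_j$); $\mathfrak{t}$ suffix-avoids $\mathfrak{s}$ if no subterm of $\mathfrak{t}$ is of the form $\mathfrak{s}[\mathfrak{r}_1,\dots,\mathfrak{r}_m]$ where all $\mathfrak{r}_j$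 are variables. -}

module Defs where

open import Data.Nat using (ℕ)
open import Data.Product using (Σ-syntax; _×_)
open import Relation.Binary.PropositionalEquality using (_≡_)
open import Relation.Binary.Construct.Closure.ReflexiveTransitive using (Star)
open import Relation.Nullary using (¬_)

data Term : Set where
  var : ℕ → Term
  M   : Term
  _·_ : Term → Term → Term

infixl 7 _·_

data _⇒_ : Term → Term → Set where
  root : ∀ s → (M · s) ⇒ (s · s)
  appˡ : ∀ {t t′} u → t ⇒ t′ → (t · u) ⇒ (t′ · u)
  appʳ : ∀ {u u′} t → u ⇒ u′ → (t · u) ⇒ (t · u′)

_≼_ : Term → Term → Set
_≼_ = Star _⇒_

Maximal : Term → Set
Maximal t = ∀ t′ → t ≼ t′ → t′ ≡ t

Minimal : Term → Set
Minimal t = ∀ t′ → t′ ≼ t → t′ ≡ t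

data _⊑_ : Term → Term → Set where
  here  : ∀ {t} → t ⊑ t
  left  : ∀ {s t u} → s ⊑ t → s ⊑ (t · u)
  right : ∀ {s t u} → s ⊑ u → s ⊑ (t · u)

_[_] : Term → (ℕ → Term) → Term
var i   [ σ ] = σ i
M       [ σ ] = M
(t · u) [ σ ] = (t [ σ ]) · (u [ σ ])

Avoids : Term → Term → Set
Avoids t s = ¬ (Σ[ σ ∈ (ℕ → Term) ] ((s [ σ ]) ⊑ t))

SuffixAvoids : Term → Term → Set
SuffixAvoids t s = ¬ (Σ[ ρ ∈ (ℕ → ℕ) ] ((s [ (λ i → var (ρ i)) ]) ⊑ t))

x₁ x₂ : Term
x₁ = var 0
x₂ = var 1

{-# OPTIONS --safe #-}
-- A step contracts a subterm M · s to s · s, and leaves the term unchanged only when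
-- s = M. Since any subterm can be contracted (or, for s · s, un-contracted) in place,
-- t is maximal iff every subterm M · s has s = M, and minimal iff every subterm s · s
-- has s = M. A term other than M is an application or a variable, which is what the
-- two avoidance conditions exclude.
module Submission where

open import Defs
open import Data.Empty using (⊥-elim)
open import Data.Nat using (ℕ)
open import Data.Product using (_×_; _,_; Σ-syntax)
open import Function.Bundles using (_⇔_; mk⇔)
open import Function.Properties.Equivalence using () renaming (trans to ⇔-trans)
open import Relation.Binary.PropositionalEquality using (_≡_; refl; sym; trans; subst)
open import Relation.Binary.Construct.Closure.ReflexiveTransitive using (Star; ε; _◅_; return)
open import Relation.Nullary using (¬_)

·-injectiveˡ : ∀ {a b c d} → a · b ≡ c · d → a ≡ c
·-injectiveˡ refl = refl

·-injectiveʳ : ∀ {a b c d} → a · b ≡ c · d → b ≡ d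
·-injectiveʳ refl = refl

graft : ∀ {a t} → a ⊑ t → Term → Term
graft here              b = b
graft (left {u = u} p)  b = graft p b · u
graft (right {t = t} p) b = t · graft p b

graft-self : ∀ {a t} (p : a ⊑ t) → graft p a ≡ t
graft-self here      = refl
graft-self (left p)  rewrite graft-self p = refl
graft-self (right p) rewrite graft-self p = refl

graft-injective : ∀ {a t b c} (p : a ⊑ t) → graft p b ≡ graft p c → b ≡ c
graft-injective here      eq = eq
graft-injective (left p)  eq = graft-injective p (·-injectiveˡ eq)
graft-injective (right p) eq = graft-injective p (·-injectiveʳ eq)

graft-⇒ : ∀ {a t b c} (p : a ⊑ t) → b ⇒ c → graft p b ⇒ graft p c
graft-⇒ here              step = step
graft-⇒ (left {u = u} p)  step = appˡ u (graft-⇒ p step)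
graft-⇒ (right {t = t} p) step = appʳ t (graft-⇒ p step)

Star-stationary : ∀ {a r} {A : Set a} {R : A → A → Set r} {x y : A} →
                  (∀ {z} → R x z → z ≡ x) → Star R x y → y ≡ x
Star-stationary fixed ε = refl
Star-stationary fixed (step ◅ steps) with fixed step
... | refl = Star-stationary fixed steps

Star-stationary⁻ : ∀ {a r} {A : Set a} {R : A → A → Set r} {x y : A} →
                   (∀ {z} → R z x → z ≡ x) → Star R y x → y ≡ x
Star-stationary⁻ fixed ε = refl
Star-stationary⁻ fixed (step ◅ steps) with Star-stationary⁻ fixed steps
... | refl = fixed step

InstancesAreM : (Term → Term) → Term → Set
InstancesAreM P t = ∀ {s} → P s ⊑ t → s ≡ M

-- For P = M ·_ and P = λ s → s · s this is, by computation of _[_], exactly the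
-- avoidance condition of the theorem.
AvoidsApplicationAndVariableInstances : (Term → Term) → Term → Set
AvoidsApplicationAndVariableInstances P t =
  ¬ (Σ[ σ ∈ (ℕ → Term) ] P (σ 0 · σ 1) ⊑ t) × ¬ (Σ[ ρ ∈ (ℕ → ℕ) ] P (var (ρ 0)) ⊑ t)

instancesAreM⇔avoids : (P : Term → Term) (t : Term) →
  InstancesAreM P t ⇔ AvoidsApplicationAndVariableInstances P t
instancesAreM⇔avoids P t = mk⇔ to from
  where
  to : InstancesAreM P t → AvoidsApplicationAndVariableInstances P t
  to onlyM = (λ { (σ , p) → app≢M (onlyM p) }) , (λ { (ρ , p) → var≢M (onlyM p) })
    where
    app≢M : ∀ {a b} → ¬ a · b ≡ M
    app≢M ()
    var≢M : ∀ {i} → ¬ var i ≡ M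
    var≢M ()

  from : AvoidsApplicationAndVariableInstances P t → InstancesAreM P t
  from (noApp , noVar) {var i} p = ⊥-elim (noVar ((λ _ → i) , p))
  from (noApp , noVar) {M}     p = refl
  from (noApp , noVar) {a · b} p = ⊥-elim (noApp (pair , p))
    where
    pair : ℕ → Term
    pair 0 = a
    pair _ = b

no-proper-step-from : ∀ {t t′} → InstancesAreM (M ·_) t → t ⇒ t′ → t′ ≡ t
no-proper-step-from onlyM (root s) with onlyM here
... | refl = refl
no-proper-step-from onlyM (appˡ u step) with no-proper-step-from (λ p → onlyM (left p)) step
... | refl = refl
no-proper-step-from onlyM (appʳ t step) with no-proper-step-from (λ p → onlyM (right p)) step
... | refl = refl

no-proper-step-into : ∀ {t t′} → InstancesAreM (λ s → s · s) t → t′ ⇒ t → t′ ≡ t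
no-proper-step-into onlyM (root s) with onlyM here
... | refl = refl
no-proper-step-into onlyM (appˡ u step) with no-proper-step-into (λ p → onlyM (left p)) step
... | refl = refl
no-proper-step-into onlyM (appʳ t step) with no-proper-step-into (λ p → onlyM (right p)) step
... | refl = refl

maximal⇔instancesAreM : (t : Term) → Maximal t ⇔ InstancesAreM (M ·_) t
maximal⇔instancesAreM t = mk⇔ to from
  where
  to : Maximal t → InstancesAreM (M ·_) t
  to maximal {s} p = ·-injectiveˡ (graft-injective p (trans contractum≡t (sym (graft-self p))))
    where
    contractum≡t : graft p (s · s) ≡ t
    contractum≡t = maximal _ (subst (_≼ graft p (s · s)) (graft-self p) (return (graft-⇒ p (root s))))

  from : InstancesAreM (M ·_) t → Maximal t
  from onlyM _ = Star-stationary (no-proper-step-from onlyM)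

minimal⇔instancesAreM : (t : Term) → Minimal t ⇔ InstancesAreM (λ s → s · s) t
minimal⇔instancesAreM t = mk⇔ to from
  where
  to : Minimal t → InstancesAreM (λ s → s · s) t
  to minimal {s} p = sym (·-injectiveˡ (graft-injective p (trans redex≡t (sym (graft-self p)))))
    where
    redex≡t : graft p (M · s) ≡ t
    redex≡t = minimal _ (subst (graft p (M · s) ≼_) (graft-self p) (return (graft-⇒ p (root s))))

  from : InstancesAreM (λ s → s · s) t → Minimal t
  from onlyM _ = Star-stationary⁻ (no-proper-step-into onlyM)

proposition2p1p4 : (t : Term) →
    (Maximal t ⇔ (Avoids t (M · (x₁ · x₂)) × SuffixAvoids t (M · x₁)))
    × (Minimal t ⇔ (Avoids t ((x₁ · x₂) · (x₁ · x₂)) × SuffixAvoids t (x₁ · x₁)))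
proposition2p1p4 t =
    ⇔-trans (maximal⇔instancesAreM t) (instancesAreM⇔avoids (M ·_) t)
  , ⇔-trans (minimal⇔instancesAreM t) (instancesAreM⇔avoids (λ s → s · s) t)
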